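{- Every permutation graph $G$ has a realizer $\pi$ such that, for every pair of twins $u$ and $v$ in $G$, the entries of $\pi$ corresponding to $u$ and $v$ lie in a subsequence $s$ of $\pi$ that occupies consecutive positions of $\pi$ and whose values are consecutive integers appearing in increasing or in decreasing order. Moreover, $u$ and $v$ are adjacent in $G$ if and only if $s$ is decreasing.
   Context: All graphs are finite and simple. A graph $G$ on $n$ vertices is a permutation graph if there is a labeling $v_1, \ldots, v_n$ of its vertices and a permutation $\pi$ of $\{1,\ldots,n\}$ such that for $i<j$, $v_i$ and $v_j$ are adjacent iff $\pi(i) > \pi(j)$; such $\pi$ is a realizer of $G$, and the vertex $v_i$ is identified with the entry $\pi(i)$. Two distinct vertices $u,v$ are twins if $N(u)\setminus\{v\} = N(v)\setminus\{u\}$, where $N(x)$ is the set of neighbors of $x$ (twins may be adjacent or not). -}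

module Defs where

open import Data.Nat using (ℕ; _≤_; _<_; _>_; _+_; _∸_)
open import Data.Fin using (Fin; toℕ)
open import Data.Fin.Permutation using (Permutation′; _⟨$⟩ʳ_; _⟨$⟩ˡ_)
open import Data.Product using (Σ; _×_; ∃; ∃-syntax)
open import Relation.Binary.PropositionalEquality using (_≡_; _≢_)
open import Relation.Nullary using (¬_)
open import Function.Bundles using (_⇔_)
open import Level using (0ℓ; suc)

record Graph (n : ℕ) : Set₁ where
  field
    Adj    : Fin n → Fin n → Set
    sym    : ∀ {u v} → Adj u v → Adj v u
    irrefl : ∀ {u} → ¬ Adj u u
open Graph public

-- A realizer: labeling v_i = σ(i) of the vertices (σ a bijection
-- positions → vertices) and a permutation π such that for i < j,
-- v_i ~ v_j iff π(i) > π(j).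
IsRealizer : ∀ {n} → Graph n → Permutation′ n → Permutation′ n → Set
IsRealizer G σ π =
  ∀ (i j : Fin _) → toℕ i < toℕ j →
    (Adj G (σ ⟨$⟩ʳ i) (σ ⟨$⟩ʳ j) ⇔ (toℕ (π ⟨$⟩ʳ i) > toℕ (π ⟨$⟩ʳ j)))

IsPermutationGraph : ∀ {n} → Graph n → Set
IsPermutationGraph {n} G = ∃[ σ ] ∃[ π ] IsRealizer {n} G σ π

Twins : ∀ {n} → Graph n → Fin n → Fin n → Set
Twins G u v =
  u ≢ v × (∀ w → w ≢ u → w ≢ v → (Adj G u w ⇔ Adj G v w))

data Direction : Set where
  increasing decreasing : Direction

ConsecutiveRun : ∀ {n} → Permutation′ n → Fin n → Fin n → Direction → Set
ConsecutiveRun π a b increasing =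
  toℕ a ≤ toℕ b ×
  (∀ k → toℕ a ≤ toℕ k → toℕ k ≤ toℕ b →
     toℕ (π ⟨$⟩ʳ k) ≡ toℕ (π ⟨$⟩ʳ a) + (toℕ k ∸ toℕ a))
ConsecutiveRun π a b decreasing =
  toℕ a ≤ toℕ b ×
  (∀ k → toℕ a ≤ toℕ k → toℕ k ≤ toℕ b →
     toℕ (π ⟨$⟩ʳ k) + (toℕ k ∸ toℕ a) ≡ toℕ (π ⟨$⟩ʳ a))

InSegment : ∀ {n} → Fin n → Fin n → Fin n → Set
InSegment a b p = toℕ a ≤ toℕ p × toℕ p ≤ toℕ b

-- Twins together with equality form an equivalence relation whose classes are cliques or
-- independent sets, and no vertex outside a class distinguishes its members. Given any
-- realizer, re-sort the positions lexicographically by (position of the class representative,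
-- own position) and the values by (value of the representative, own position), the own
-- position taken in reverse when the class is a clique. Between classes adjacency is that of
-- the representatives, which the first coordinates reproduce; inside a class the second
-- coordinates make every pair an inversion exactly when the class is a clique. Each class then
-- occupies consecutive positions carrying consecutive values, increasing for an independent
-- class and decreasing for a clique, and any two twins lie in such a run.

module Submission where

open import Defs hiding (sym; irrefl)
open import Data.Nat using (ℕ; zero; suc; _+_; _*_; _∸_; _≤_; _<_; _≤?_; _<?_; z≤n; s≤s)
open import Data.Nat.Properties
  using (<-cmp; <-asym; <-irrefl; <-≤-trans; <⇒≤; ≤-refl; ≤-reflexive; ≤-antisym; ≤-total;
         ≮⇒≥; ≤⇒≯; <⇒≱; ≰⇒>; ≤∧≢⇒<; m≤n⇒m≤1+n; m≤m+n; m<m+n; +-suc; +-monoʳ-<; +-cancelˡ-<;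
         m+n∸m≡n; ∸-monoʳ-<; suc-injective)
open import Data.Fin using (Fin; zero; suc; toℕ; fromℕ<; punchOut; combine; opposite)
import Data.Fin.Properties as Finₚ
open Finₚ using (_≟_)
open import Data.Fin.Permutation
  using (Permutation′; permutation; _⟨$⟩ʳ_; _⟨$⟩ˡ_; inverseˡ; inverseʳ; flip; _∘ₚ_)
open import Data.Product using (_×_; _,_; proj₁; proj₂; ∃-syntax)
open import Data.Sum using (_⊎_; inj₁; inj₂; [_,_]′)
open import Function using (_∘_)
open import Function.Bundles using (_⇔_; mk⇔; Equivalence)
open import Function.Construct.Symmetry using (⇔-sym)
open import Function.Construct.Composition using (_⇔-∘_)
open import Function.Properties.Equivalence using (⇔-setoid)
open import Function.Definitions using (Injective)
open import Level using (0ℓ)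
open import Relation.Binary using (Rel; Decidable; IsEquivalence; tri<; tri≈; tri>)
open import Relation.Binary.PropositionalEquality
import Relation.Binary.Reasoning.Setoid
open import Relation.Nullary using (Dec; yes; no; ¬_; contradiction)
open import Relation.Nullary.Decidable using (_×-dec_; _⊎-dec_; _→-dec_; ¬?; map′)
open import Relation.Unary using (Pred) renaming (Decidable to Decidable₁)

open Equivalence using (to; from)

module ⇔-Reasoning = Relation.Binary.Reasoning.Setoid (⇔-setoid 0ℓ)

_⇔?_ : ∀ {A B : Set} → Dec A → Dec B → Dec (A ⇔ B)
a? ⇔? b? = map′ (λ (f , g) → mk⇔ f g) (λ e → to e , from e) ((a? →-dec b?) ×-dec (b? →-dec a?))

<⇔<⇒≤⇔≤ : ∀ {m n p q} → n < m ⇔ q < p → m ≤ n ⇔ p ≤ q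
<⇔<⇒≤⇔≤ n<m⇔q<p = mk⇔ (λ m≤n → ≮⇒≥ (≤⇒≯ m≤n ∘ from n<m⇔q<p)) (λ p≤q → ≮⇒≥ (≤⇒≯ p≤q ∘ to n<m⇔q<p))

-- Counting in Fin n

count : ∀ {n} {P : Pred (Fin n) 0ℓ} → Decidable₁ P → ℕ
count {zero}  P? = 0
count {suc n} P? with P? zero
... | yes _ = suc (count (P? ∘ suc))
... | no  _ = count (P? ∘ suc)

count-cong : ∀ {n} {P Q : Pred (Fin n) 0ℓ} (P? : Decidable₁ P) (Q? : Decidable₁ Q) →
             (∀ y → P y ⇔ Q y) → count P? ≡ count Q?
count-cong {zero}  P? Q? P⇔Q = refl
count-cong {suc n} P? Q? P⇔Q with P? zero | Q? zero
... | yes _ | yes _ = cong suc (count-cong (P? ∘ suc) (Q? ∘ suc) (P⇔Q ∘ suc))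
... | yes p | no ¬q = contradiction (to (P⇔Q zero) p) ¬q
... | no ¬p | yes q = contradiction (from (P⇔Q zero) q) ¬p
... | no _  | no _  = count-cong (P? ∘ suc) (Q? ∘ suc) (P⇔Q ∘ suc)

count-split : ∀ {n} {P Q : Pred (Fin n) 0ℓ} (P? : Decidable₁ P) (Q? : Decidable₁ Q) →
              count P? ≡ count (λ y → P? y ×-dec Q? y) + count (λ y → P? y ×-dec ¬? (Q? y))
count-split {zero}  P? Q? = refl
count-split {suc n} P? Q? with P? zero | Q? zero
... | yes _ | yes _ = cong suc (count-split (P? ∘ suc) (Q? ∘ suc))
... | yes _ | no _  = trans (cong suc (count-split (P? ∘ suc) (Q? ∘ suc))) (sym (+-suc _ _))
... | no _  | _     = count-split (P? ∘ suc) (Q? ∘ suc)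

count-empty : ∀ {n} {P : Pred (Fin n) 0ℓ} (P? : Decidable₁ P) → (∀ y → ¬ P y) → count P? ≡ 0
count-empty {zero}  P? ¬P = refl
count-empty {suc n} P? ¬P with P? zero
... | yes p = contradiction p (¬P zero)
... | no _  = count-empty (P? ∘ suc) (¬P ∘ suc)

count-singleton : ∀ {n} (z : Fin n) → count (_≟ z) ≡ 1
count-singleton {suc n} zero = cong suc (count-empty {n} (λ y → suc y ≟ zero) (λ _ ()))
count-singleton {suc n} (suc z) =
  trans (count-cong (λ y → suc y ≟ suc z) (_≟ z) (λ _ → mk⇔ Finₚ.suc-injective (cong suc)))
        (count-singleton z)

count-pos : ∀ {n} {P : Pred (Fin n) 0ℓ} (P? : Decidable₁ P) {z} → P z → 0 < count P?
count-pos {suc n} P? {z} pz with P? zero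
... | yes _ = s≤s z≤n
count-pos {suc n} P? {zero}  pz | no ¬p = contradiction pz ¬p
count-pos {suc n} P? {suc z} pz | no _  = count-pos (P? ∘ suc) pz

count≤n : ∀ {n} {P : Pred (Fin n) 0ℓ} (P? : Decidable₁ P) → count P? ≤ n
count≤n {zero}  P? = z≤n
count≤n {suc n} P? with P? zero
... | yes _ = s≤s (count≤n (P? ∘ suc))
... | no  _ = m≤n⇒m≤1+n (count≤n (P? ∘ suc))

count<n : ∀ {n} {P : Pred (Fin n) 0ℓ} (P? : Decidable₁ P) {z} → ¬ P z → count P? < n
count<n {suc n} P? {z} ¬pz with P? zero
count<n {suc n} P? {zero}  ¬pz | yes p = contradiction p ¬pz
count<n {suc n} P? {suc z} ¬pz | yes _ = s≤s (count<n (P? ∘ suc) ¬pz)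
count<n {suc n} P? {zero}  ¬pz | no _  = s≤s (count≤n (P? ∘ suc))
count<n {suc n} P? {suc z} ¬pz | no _  = m≤n⇒m≤1+n (count<n (P? ∘ suc) ¬pz)

least : ∀ {n} {P : Pred (Fin n) 0ℓ} → Decidable₁ P → ∀ {x} → P x →
        ∃[ z ] (P z × ∀ {w} → P w → toℕ z ≤ toℕ w)
least {suc n} P? px with P? zero
... | yes p₀ = zero , p₀ , λ _ → z≤n
least {suc n} P? {zero}  px | no ¬p₀ = contradiction px ¬p₀
least {suc n} {P} P? {suc x} px | no ¬p₀ with least (P? ∘ suc) px
... | z , pz , minimal = suc z , pz , bound
  where
  bound : ∀ {w} → P w → toℕ (suc z) ≤ toℕ w
  bound {zero}  p₀ = contradiction p₀ ¬p₀
  bound {suc w} pw = s≤s (minimal pw)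

injective⇒surjective : ∀ {n} {f : Fin n → Fin n} → Injective _≡_ _≡_ f → ∀ k → ∃[ x ] f x ≡ k
injective⇒surjective {suc m} {f} f-injective k with Finₚ.any? (λ x → f x ≟ k)
... | yes hit = hit
... | no miss = contradiction (Finₚ.injective⇒≤ skip-injective) (<-irrefl refl)
  where
  k≢f : ∀ x → k ≢ f x
  k≢f x k≡fx = miss (x , sym k≡fx)
  -- if f misses k, punching k out of its values injects Fin (suc m) into Fin m
  skip-injective : Injective _≡_ _≡_ (λ x → punchOut (k≢f x))
  skip-injective = f-injective ∘ Finₚ.punchOut-injective (k≢f _) (k≢f _)

injective⇒permutation : ∀ {n} {f : Fin n → Fin n} → Injective _≡_ _≡_ f → Permutation′ n
injective⇒permutation {f = f} f-injective =
  permutation f inverse (proj₂ ∘ surjective) (λ x → f-injective (proj₂ (surjective (f x))))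
  where
  surjective : ∀ k → ∃[ x ] f x ≡ k
  surjective = injective⇒surjective f-injective
  inverse : Fin _ → Fin _
  inverse = proj₁ ∘ surjective

⟨$⟩ˡ-injective : ∀ {n} (ρ : Permutation′ n) → Injective _≡_ _≡_ (ρ ⟨$⟩ˡ_)
⟨$⟩ˡ-injective ρ {x} {y} ρx≡ρy = trans (sym (inverseʳ ρ)) (trans (cong (ρ ⟨$⟩ʳ_) ρx≡ρy) (inverseʳ ρ))

⟨$⟩ʳ-injective : ∀ {n} (ρ : Permutation′ n) → Injective _≡_ _≡_ (ρ ⟨$⟩ʳ_)
⟨$⟩ʳ-injective ρ {x} {y} ρx≡ρy = trans (sym (inverseˡ ρ)) (trans (cong (ρ ⟨$⟩ˡ_) ρx≡ρy) (inverseˡ ρ))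

-- Ranking by an injective key

module Ranking {n} (f : Fin n → ℕ) (f-injective : Injective _≡_ _≡_ f) where

  rank : Fin n → ℕ
  rank x = count (λ y → f y <? f x)

  Ico : Fin n → Fin n → Pred (Fin n) 0ℓ
  Ico u x y = f u ≤ f y × f y < f x

  Ico? : ∀ u x → Decidable₁ (Ico u x)
  Ico? u x y = (f u ≤? f y) ×-dec (f y <? f x)

  Ioc : Fin n → Fin n → Pred (Fin n) 0ℓ
  Ioc u x y = f u < f y × f y ≤ f x

  Ioc? : ∀ u x → Decidable₁ (Ioc u x)
  Ioc? u x y = (f u <? f y) ×-dec (f y ≤? f x)

  rank-split : ∀ {u x} → f u ≤ f x → rank x ≡ rank u + count (Ico? u x)
  rank-split {u} {x} u≤x =
    trans (count-split (λ y → f y <? f x) (λ y → f y <? f u))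
          (cong₂ _+_ (count-cong _ _ below-u) (count-cong _ _ between))
    where
    below-u : ∀ y → (f y < f x × f y < f u) ⇔ f y < f u
    below-u y = mk⇔ proj₂ (λ y<u → <-≤-trans y<u u≤x , y<u)
    between : ∀ y → (f y < f x × ¬ f y < f u) ⇔ Ico u x y
    between y = mk⇔ (λ (y<x , y≮u) → ≮⇒≥ y≮u , y<x) (λ (u≤y , y<x) → y<x , ≤⇒≯ u≤y)

  rank-mono-≤ : ∀ {x y} → f x ≤ f y → rank x ≤ rank y
  rank-mono-≤ {x} x≤y = subst (rank x ≤_) (sym (rank-split x≤y)) (m≤m+n (rank x) _)

  rank-mono-< : ∀ {x y} → f x < f y → rank x < rank y
  rank-mono-< {x} {y} x<y = subst (rank x <_) (sym (rank-split (<⇒≤ x<y)))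
                                  (m<m+n (rank x) (count-pos (Ico? x y) (≤-refl , x<y)))

  rank-<⇔ : ∀ {x y} → f x < f y ⇔ rank x < rank y
  rank-<⇔ = mk⇔ rank-mono-< (λ rx<ry → ≰⇒> (<⇒≱ rx<ry ∘ rank-mono-≤))

  rank-≤⇔ : ∀ {x y} → f x ≤ f y ⇔ rank x ≤ rank y
  rank-≤⇔ = mk⇔ rank-mono-≤ (λ rx≤ry → ≮⇒≥ (≤⇒≯ rx≤ry ∘ rank-mono-<))

  rank<n : ∀ x → rank x < n
  rank<n x = count<n (λ y → f y <? f x) (<-irrefl refl)

  rankFin : Fin n → Fin n
  rankFin x = fromℕ< (rank<n x)

  toℕ-rankFin : ∀ x → toℕ (rankFin x) ≡ rank x
  toℕ-rankFin x = Finₚ.toℕ-fromℕ< (rank<n x)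

  rankFin-injective : Injective _≡_ _≡_ rankFin
  rankFin-injective {x} {y} rx≡ry =
    f-injective (≤-antisym (from rank-≤⇔ (≤-reflexive same-rank))
                           (from rank-≤⇔ (≤-reflexive (sym same-rank))))
    where
    same-rank : rank x ≡ rank y
    same-rank = trans (sym (toℕ-rankFin x)) (trans (cong toℕ rx≡ry) (toℕ-rankFin y))

  ranking : Permutation′ n
  ranking = injective⇒permutation rankFin-injective

  rank-gap : ∀ {u x} → f u ≤ f x → rank x ∸ rank u ≡ count (Ico? u x)
  rank-gap {u} u≤x = trans (cong (_∸ rank u) (rank-split u≤x)) (m+n∸m≡n (rank u) _)

  -- both are the closed interval from u to x with one endpoint removed
  count-Ico≡count-Ioc : ∀ {u x} → f u ≤ f x → count (Ico? u x) ≡ count (Ioc? u x)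
  count-Ico≡count-Ioc {u} {x} u≤x = suc-injective (begin
    suc (count (Ico? u x))                       ≡⟨ cong₂ _+_ (sym (endpoint x u≤x ≤-refl)) (count-cong _ _ drop-x) ⟩
    count (λ y → Icc? y ×-dec (y ≟ x)) + _      ≡⟨ sym (count-split Icc? (_≟ x)) ⟩
    count Icc?                                   ≡⟨ count-split Icc? (_≟ u) ⟩
    count (λ y → Icc? y ×-dec (y ≟ u)) + _      ≡⟨ cong₂ _+_ (endpoint u ≤-refl u≤x) (count-cong _ _ drop-u) ⟩
    suc (count (Ioc? u x))                       ∎)
    where
    open ≡-Reasoning
    Icc? : Decidable₁ (λ y → f u ≤ f y × f y ≤ f x)
    Icc? y = (f u ≤? f y) ×-dec (f y ≤? f x)
    drop-x : ∀ y → Ico u x y ⇔ ((f u ≤ f y × f y ≤ f x) × y ≢ x)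
    drop-x y = mk⇔ (λ (u≤y , y<x) → (u≤y , <⇒≤ y<x) , λ { refl → <-irrefl refl y<x })
                   (λ ((u≤y , y≤x) , y≢x) → u≤y , ≤∧≢⇒< y≤x (y≢x ∘ f-injective))
    endpoint : ∀ z → f u ≤ f z → f z ≤ f x → count (λ y → Icc? y ×-dec (y ≟ z)) ≡ 1
    endpoint z u≤z z≤x =
      trans (count-cong _ (_≟ z) (λ y → mk⇔ proj₂ (λ { refl → (u≤z , z≤x) , refl }))) (count-singleton z)
    drop-u : ∀ y → ((f u ≤ f y × f y ≤ f x) × y ≢ u) ⇔ Ioc u x y
    drop-u y = mk⇔ (λ ((u≤y , y≤x) , y≢u) → ≤∧≢⇒< u≤y (y≢u ∘ sym ∘ f-injective) , y≤x)
                   (λ (u<y , y≤x) → (<⇒≤ u<y , y≤x) , λ { refl → <-irrefl refl u<y })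

-- Realizers from pairs of keys

Convex : ∀ {n} → (Fin n → ℕ) → Pred (Fin n) 0ℓ → Set
Convex f S = ∀ {a b y} → S a → S b → f a ≤ f y → f y ≤ f b → S y

Monotone : ∀ {n} → Direction → (f g : Fin n → ℕ) → Pred (Fin n) 0ℓ → Set
Monotone increasing f g S = ∀ {y z} → S y → S z → f y < f z ⇔ g y < g z
Monotone decreasing f g S = ∀ {y z} → S y → S z → f y < f z ⇔ g z < g y

-- a realizer seen from the vertices: f orders their positions and g their values
Represents : ∀ {n} → Graph n → (f g : Fin n → ℕ) → Set
Represents G f g = ∀ x y → f x < f y → Adj G x y ⇔ g y < g x

realizer⇒represents : ∀ {n} {G : Graph n} {σ π} → IsRealizer G σ π →
                      Represents G (toℕ ∘ (σ ⟨$⟩ˡ_)) (toℕ ∘ (π ⟨$⟩ʳ_) ∘ (σ ⟨$⟩ˡ_))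
realizer⇒represents {G = G} {σ} {π} realizes x y x<y =
  subst₂ (λ a b → Adj G a b ⇔ toℕ (π ⟨$⟩ʳ (σ ⟨$⟩ˡ y)) < toℕ (π ⟨$⟩ʳ (σ ⟨$⟩ˡ x)))
         (inverseʳ σ) (inverseʳ σ) (realizes (σ ⟨$⟩ˡ x) (σ ⟨$⟩ˡ y) x<y)

represents⇒adj? : ∀ {n} {G : Graph n} {f g : Fin n → ℕ} → Injective _≡_ _≡_ f → Represents G f g →
                  Decidable (Adj G)
represents⇒adj? {G = G} {f} {g} f-injective represents x y with <-cmp (f x) (f y)
... | tri< x<y _ _ = map′ (from (represents x y x<y)) (to (represents x y x<y)) (g y <? g x)
... | tri≈ _ fx≡fy _ = no (Graph.irrefl G ∘ subst (Adj G x) (sym (f-injective fx≡fy)))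
... | tri> _ _ y<x =
  map′ (Graph.sym G ∘ from (represents y x y<x)) (to (represents y x y<x) ∘ Graph.sym G) (g x <? g y)

module RankRealizer {n} {f g : Fin n → ℕ}
                    (f-injective : Injective _≡_ _≡_ f) (g-injective : Injective _≡_ _≡_ g) where

  module P = Ranking f f-injective
  module V = Ranking g g-injective

  -- the vertex of f-rank k sits at position k and carries the value of its g-rank
  σ′ : Permutation′ n
  σ′ = flip P.ranking

  π′ : Permutation′ n
  π′ = σ′ ∘ₚ V.ranking

  rankFin-mono : ∀ {u v} → f u ≤ f v → toℕ (P.rankFin u) ≤ toℕ (P.rankFin v)
  rankFin-mono u≤v = subst₂ _≤_ (sym (P.toℕ-rankFin _)) (sym (P.toℕ-rankFin _)) (to P.rank-≤⇔ u≤v)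

  toℕ-position : ∀ k → toℕ k ≡ P.rank (σ′ ⟨$⟩ʳ k)
  toℕ-position k = trans (cong toℕ (sym (inverseʳ P.ranking))) (P.toℕ-rankFin (σ′ ⟨$⟩ʳ k))

  toℕ-π′ : ∀ k → toℕ (π′ ⟨$⟩ʳ k) ≡ V.rank (σ′ ⟨$⟩ʳ k)
  toℕ-π′ k = V.toℕ-rankFin (σ′ ⟨$⟩ʳ k)

  toℕ-π′-rankFin : ∀ u → toℕ (π′ ⟨$⟩ʳ P.rankFin u) ≡ V.rank u
  toℕ-π′-rankFin u = trans (toℕ-π′ (P.rankFin u)) (cong V.rank (inverseˡ P.ranking))

  represents⇒realizer : ∀ {G} → Represents G f g → IsRealizer G σ′ π′
  represents⇒realizer {G} represents i j i<j = begin
    Adj G x y                      ≈⟨ represents x y (from P.rank-<⇔ (subst₂ _<_ (toℕ-position i) (toℕ-position j) i<j)) ⟩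
    g y < g x                      ≈⟨ V.rank-<⇔ ⟩
    V.rank y < V.rank x            ≡⟨ cong₂ _<_ (toℕ-π′ j) (toℕ-π′ i) ⟨
    toℕ (π′ ⟨$⟩ʳ j) < toℕ (π′ ⟨$⟩ʳ i) ∎
    where
    open ⇔-Reasoning
    x y : Fin n
    x = σ′ ⟨$⟩ʳ i
    y = σ′ ⟨$⟩ʳ j

  module _ {S : Pred (Fin n) 0ℓ} (f-convex : Convex f S) (g-convex : Convex g S) where

    Ico-transfer : Monotone increasing f g S → ∀ {u x} → S u → S x →
                   ∀ y → P.Ico u x y ⇔ V.Ico u x y
    Ico-transfer mono {u} {x} Su Sx y = mk⇔
      (λ (u≤y , y<x) → let Sy = f-convex Su Sx u≤y (<⇒≤ y<x) in
                         to (<⇔<⇒≤⇔≤ (mono Sy Su)) u≤y , to (mono Sy Sx) y<x)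
      (λ (u≤y , y<x) → let Sy = g-convex Su Sx u≤y (<⇒≤ y<x) in
                         from (<⇔<⇒≤⇔≤ (mono Sy Su)) u≤y , from (mono Sy Sx) y<x)

    Ico-reverse : Monotone decreasing f g S → ∀ {u x} → S u → S x →
                  ∀ y → P.Ioc u x y ⇔ V.Ico x u y
    Ico-reverse mono {u} {x} Su Sx y = mk⇔
      (λ (u<y , y≤x) → let Sy = f-convex Su Sx (<⇒≤ u<y) y≤x in
                         to (<⇔<⇒≤⇔≤ (mono Sx Sy)) y≤x , to (mono Su Sy) u<y)
      (λ (x≤y , y<u) → let Sy = g-convex Sx Su x≤y (<⇒≤ y<u) in
                         from (mono Su Sy) y<u , from (<⇔<⇒≤⇔≤ (mono Sx Sy)) x≤y)

    rank-shift-increasing : Monotone increasing f g S → ∀ {u x} → S u → S x → f u ≤ f x →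
                            V.rank x ≡ V.rank u + (P.rank x ∸ P.rank u)
    rank-shift-increasing mono {u} {x} Su Sx u≤x = begin
      V.rank x                          ≡⟨ V.rank-split (to (<⇔<⇒≤⇔≤ (mono Sx Su)) u≤x) ⟩
      V.rank u + count (V.Ico? u x)     ≡⟨ cong (V.rank u +_) (count-cong _ _ (⇔-sym ∘ Ico-transfer mono Su Sx)) ⟩
      V.rank u + count (P.Ico? u x)     ≡⟨ cong (V.rank u +_) (P.rank-gap u≤x) ⟨
      V.rank u + (P.rank x ∸ P.rank u)  ∎
      where open ≡-Reasoning

    rank-shift-decreasing : Monotone decreasing f g S → ∀ {u x} → S u → S x → f u ≤ f x →
                            V.rank u ≡ V.rank x + (P.rank x ∸ P.rank u)
    rank-shift-decreasing mono {u} {x} Su Sx u≤x = begin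
      V.rank u                          ≡⟨ V.rank-split (to (<⇔<⇒≤⇔≤ (mono Sx Su)) u≤x) ⟩
      V.rank x + count (V.Ico? x u)     ≡⟨ cong (V.rank x +_) (count-cong _ _ (⇔-sym ∘ Ico-reverse mono Su Sx)) ⟩
      V.rank x + count (P.Ioc? u x)     ≡⟨ cong (V.rank x +_) (P.count-Ico≡count-Ioc u≤x) ⟨
      V.rank x + count (P.Ico? u x)     ≡⟨ cong (V.rank x +_) (P.rank-gap u≤x) ⟨
      V.rank x + (P.rank x ∸ P.rank u)  ∎
      where open ≡-Reasoning

    module Segment {u v k : Fin n} (Su : S u) (Sv : S v)
                   (a≤k : toℕ (P.rankFin u) ≤ toℕ k) (k≤b : toℕ k ≤ toℕ (P.rankFin v)) where
      x : Fin n
      x = σ′ ⟨$⟩ʳ k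
      u≤x : f u ≤ f x
      u≤x = from P.rank-≤⇔ (subst₂ _≤_ (P.toℕ-rankFin u) (toℕ-position k) a≤k)
      Sx : S x
      Sx = f-convex Su Sv u≤x (from P.rank-≤⇔ (subst₂ _≤_ (toℕ-position k) (P.toℕ-rankFin v) k≤b))
      gap : toℕ k ∸ toℕ (P.rankFin u) ≡ P.rank x ∸ P.rank u
      gap = cong₂ _∸_ (toℕ-position k) (P.toℕ-rankFin u)

    increasing-step : Monotone increasing f g S → ∀ {u v k} → S u → S v →
                      toℕ (P.rankFin u) ≤ toℕ k → toℕ k ≤ toℕ (P.rankFin v) →
                      toℕ (π′ ⟨$⟩ʳ k) ≡ toℕ (π′ ⟨$⟩ʳ P.rankFin u) + (toℕ k ∸ toℕ (P.rankFin u))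
    increasing-step mono {u} {v} {k} Su Sv a≤k k≤b = begin
      toℕ (π′ ⟨$⟩ʳ k)                  ≡⟨ toℕ-π′ k ⟩
      V.rank x                          ≡⟨ rank-shift-increasing mono Su Sx u≤x ⟩
      V.rank u + (P.rank x ∸ P.rank u)  ≡⟨ cong₂ _+_ (toℕ-π′-rankFin u) gap ⟨
      toℕ (π′ ⟨$⟩ʳ P.rankFin u) + (toℕ k ∸ toℕ (P.rankFin u)) ∎
      where
      open ≡-Reasoning
      open Segment Su Sv a≤k k≤b

    decreasing-step : Monotone decreasing f g S → ∀ {u v k} → S u → S v →
                      toℕ (P.rankFin u) ≤ toℕ k → toℕ k ≤ toℕ (P.rankFin v) →
                      toℕ (π′ ⟨$⟩ʳ k) + (toℕ k ∸ toℕ (P.rankFin u)) ≡ toℕ (π′ ⟨$⟩ʳ P.rankFin u)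
    decreasing-step mono {u} {v} {k} Su Sv a≤k k≤b = begin
      toℕ (π′ ⟨$⟩ʳ k) + (toℕ k ∸ toℕ (P.rankFin u)) ≡⟨ cong₂ _+_ (toℕ-π′ k) gap ⟩
      V.rank x + (P.rank x ∸ P.rank u)             ≡⟨ rank-shift-decreasing mono Su Sx u≤x ⟨
      V.rank u                                     ≡⟨ toℕ-π′-rankFin u ⟨
      toℕ (π′ ⟨$⟩ʳ P.rankFin u)                    ∎
      where
      open ≡-Reasoning
      open Segment Su Sv a≤k k≤b

    consecutiveRun : ∀ d → Monotone d f g S → ∀ {u v} → S u → S v → f u ≤ f v →
                     ConsecutiveRun π′ (P.rankFin u) (P.rankFin v) d
    consecutiveRun increasing mono Su Sv u≤v = rankFin-mono u≤v , λ _ → increasing-step mono Su Sv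
    consecutiveRun decreasing mono Su Sv u≤v = rankFin-mono u≤v , λ _ → decreasing-step mono Su Sv

-- Lexicographic keys and reversal

combine-<⇔ : ∀ {m n} {i j : Fin m} {k l : Fin n} →
             toℕ (combine i k) < toℕ (combine j l) ⇔ (toℕ i < toℕ j ⊎ (i ≡ j × toℕ k < toℕ l))
combine-<⇔ {m} {n} {i} {j} {k} {l} = mk⇔ split join
  where
  same-row : ∀ {i k l} → toℕ (combine {m} {n} i k) < toℕ (combine i l) ⇔ toℕ k < toℕ l
  same-row {i} {k} {l} rewrite Finₚ.toℕ-combine i k | Finₚ.toℕ-combine i l =
    mk⇔ (+-cancelˡ-< (n * toℕ i) _ _) (+-monoʳ-< (n * toℕ i))
  split : toℕ (combine i k) < toℕ (combine j l) → toℕ i < toℕ j ⊎ (i ≡ j × toℕ k < toℕ l)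
  split ik<jl with Finₚ.<-cmp i j
  ... | tri< i<j _ _ = inj₁ i<j
  ... | tri≈ _ refl _ = inj₂ (refl , to same-row ik<jl)
  ... | tri> _ _ j<i = contradiction (Finₚ.combine-monoˡ-< l k j<i) (<-asym ik<jl)
  join : toℕ i < toℕ j ⊎ (i ≡ j × toℕ k < toℕ l) → toℕ (combine i k) < toℕ (combine j l)
  join (inj₁ i<j) = Finₚ.combine-monoˡ-< k l i<j
  join (inj₂ (refl , k<l)) = from same-row k<l

combine-<⇔-sameˡ : ∀ {m n} {i j : Fin m} {k l : Fin n} → i ≡ j →
                   toℕ (combine i k) < toℕ (combine j l) ⇔ toℕ k < toℕ l
combine-<⇔-sameˡ {i = i} {k = k} {l} refl =
  mk⇔ (second ∘ to (combine-<⇔ {i = i} {k = k} {l}))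
      (from (combine-<⇔ {i = i} {k = k} {l}) ∘ inj₂ ∘ (refl ,_))
  where
  second : toℕ i < toℕ i ⊎ (i ≡ i × toℕ k < toℕ l) → toℕ k < toℕ l
  second (inj₁ i<i) = contradiction i<i (<-irrefl refl)
  second (inj₂ (_ , p)) = p

combine-<⇔-distinctˡ : ∀ {m n} {i j : Fin m} {k l : Fin n} → i ≢ j →
                       toℕ (combine i k) < toℕ (combine j l) ⇔ toℕ i < toℕ j
combine-<⇔-distinctˡ {i = i} {j} {k} {l} i≢j =
  mk⇔ (first ∘ to combine-<⇔) (from (combine-<⇔ {i = i} {j} {k} {l}) ∘ inj₁)
  where
  first : toℕ i < toℕ j ⊎ (i ≡ j × toℕ k < toℕ l) → toℕ i < toℕ j
  first (inj₁ i<j) = i<j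
  first (inj₂ (i≡j , _)) = contradiction i≡j i≢j

combine-squeezeˡ : ∀ {m n} {i i′ j : Fin m} {k k′ l : Fin n} → i ≡ j →
                   toℕ (combine i k) ≤ toℕ (combine i′ k′) → toℕ (combine i′ k′) ≤ toℕ (combine j l) →
                   i′ ≡ i
combine-squeezeˡ {k = k} {k′} {l} refl ik≤ik′ ik′≤jl = Finₚ.≤-antisym (below ik′≤jl) (below ik≤ik′)
  where
  below : ∀ {a b c d} → toℕ (combine a c) ≤ toℕ (combine b d) → toℕ a ≤ toℕ b
  below {c = c} {d} ac≤bd = ≮⇒≥ (λ b<a → <⇒≱ (Finₚ.combine-monoˡ-< d c b<a) ac≤bd)

orient : ∀ {n} → Direction → Fin n → Fin n
orient increasing i = i
orient decreasing i = opposite i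

orient-injective : ∀ {n} d → Injective _≡_ _≡_ (orient {n} d)
orient-injective increasing i≡j = i≡j
orient-injective decreasing {i} {j} oi≡oj =
  trans (sym (Finₚ.opposite-involutive i)) (trans (cong opposite oi≡oj) (Finₚ.opposite-involutive j))

opposite-<-antitone : ∀ {n} {i j : Fin n} → toℕ i < toℕ j → toℕ (opposite j) < toℕ (opposite i)
opposite-<-antitone {n} {i} {j} i<j =
  subst₂ _<_ (sym (Finₚ.opposite-prop j)) (sym (Finₚ.opposite-prop i)) (∸-monoʳ-< (s≤s i<j) (Finₚ.toℕ<n j))

opposite-<⇔ : ∀ {n} {i j : Fin n} → toℕ i < toℕ j ⇔ toℕ (opposite j) < toℕ (opposite i)
opposite-<⇔ {i = i} {j} = mk⇔ opposite-<-antitone reflect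
  where
  reflect : toℕ (opposite j) < toℕ (opposite i) → toℕ i < toℕ j
  reflect = subst₂ (λ a b → toℕ a < toℕ b) (Finₚ.opposite-involutive i) (Finₚ.opposite-involutive j)
          ∘ opposite-<-antitone

orient-reverses⇔ : ∀ {n} d {i j : Fin n} → toℕ i < toℕ j →
                   toℕ (orient d j) < toℕ (orient d i) ⇔ d ≡ decreasing
orient-reverses⇔ increasing i<j = mk⇔ (λ j<i → contradiction j<i (<-asym i<j)) λ ()
orient-reverses⇔ decreasing i<j = mk⇔ (λ _ → refl) (λ _ → opposite-<-antitone i<j)

orient-monotone : ∀ {m n} d {f g : Fin n → ℕ} {h : Fin n → Fin m} {S : Pred (Fin n) 0ℓ} →
                  (∀ {y z} → S y → S z → f y < f z ⇔ toℕ (h y) < toℕ (h z)) →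
                  (∀ {y z} → S y → S z → g y < g z ⇔ toℕ (orient d (h y)) < toℕ (orient d (h z))) →
                  Monotone d f g S
orient-monotone increasing f≅h g≅h Sy Sz = ⇔-sym (g≅h Sy Sz) ⇔-∘ f≅h Sy Sz
orient-monotone decreasing f≅h g≅h Sy Sz = ⇔-sym (g≅h Sz Sy) ⇔-∘ (opposite-<⇔ ⇔-∘ f≅h Sy Sz)

direction : ∀ {A : Set} → Dec A → Direction
direction (yes _) = decreasing
direction (no _)  = increasing

direction⇔ : ∀ {A : Set} (a? : Dec A) → A ⇔ direction a? ≡ decreasing
direction⇔ (yes a) = mk⇔ (λ _ → refl) (λ _ → a)
direction⇔ (no ¬a) = mk⇔ (λ a → contradiction a ¬a) λ ()

-- Twin classes

module TwinClasses {n} (G : Graph n) where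

  adj-sym : ∀ {x y} → Adj G x y → Adj G y x
  adj-sym = Graph.sym G

  adj⇒≢ : ∀ {x y} → Adj G x y → x ≢ y
  adj⇒≢ a refl = Graph.irrefl G a

  twins-sym : ∀ {u v} → Twins G u v → Twins G v u
  twins-sym (u≢v , N) = u≢v ∘ sym , λ w w≢v w≢u → ⇔-sym (N w w≢u w≢v)

  twins-trans : ∀ {u v w} → Twins G u v → Twins G v w → u ≢ w → Twins G u w
  twins-trans {u} {v} {w} (u≢v , Nuv) (v≢w , Nvw) u≢w = u≢w , N
    where
    N : ∀ z → z ≢ u → z ≢ w → Adj G u z ⇔ Adj G w z
    N z z≢u z≢w with z ≟ v
    ... | no z≢v = Nvw z z≢v z≢w ⇔-∘ Nuv z z≢u z≢v
    ... | yes refl = mk⇔ (adj-sym ∘ to uw⇔vw ∘ adj-sym ∘ to vu⇔wu ∘ adj-sym)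
                         (adj-sym ∘ from vu⇔wu ∘ adj-sym ∘ from uw⇔vw ∘ adj-sym)
      where
      vu⇔wu : Adj G v u ⇔ Adj G w u
      vu⇔wu = Nvw u u≢v u≢w
      uw⇔vw : Adj G u w ⇔ Adj G v w
      uw⇔vw = Nuv w (u≢w ∘ sym) (v≢w ∘ sym)

  TwinOrEq : Rel (Fin n) 0ℓ
  TwinOrEq x y = x ≡ y ⊎ Twins G x y

  twinOrEq-isEquivalence : IsEquivalence TwinOrEq
  twinOrEq-isEquivalence = record { refl = inj₁ refl ; sym = sym′ ; trans = trans′ }
    where
    sym′ : ∀ {x y} → TwinOrEq x y → TwinOrEq y x
    sym′ (inj₁ x≡y) = inj₁ (sym x≡y)
    sym′ (inj₂ t)   = inj₂ (twins-sym t)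
    trans′ : ∀ {x y z} → TwinOrEq x y → TwinOrEq y z → TwinOrEq x z
    trans′ (inj₁ refl) yz = yz
    trans′ (inj₂ t) (inj₁ refl) = inj₂ t
    trans′ {x} {z = z} (inj₂ t) (inj₂ t′) with x ≟ z
    ... | yes x≡z = inj₁ x≡z
    ... | no x≢z  = inj₂ (twins-trans t t′ x≢z)

  open IsEquivalence twinOrEq-isEquivalence public
    renaming (refl to twinOrEq-refl; sym to twinOrEq-sym; trans to twinOrEq-trans)

  twinOrEq⇒twins : ∀ {x y} → TwinOrEq x y → x ≢ y → Twins G x y
  twinOrEq⇒twins (inj₁ x≡y) x≢y = contradiction x≡y x≢y
  twinOrEq⇒twins (inj₂ t) _ = t

  same-class : ∀ {ρ x y} → TwinOrEq ρ x → TwinOrEq ρ y → TwinOrEq x y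
  same-class ρx ρy = twinOrEq-trans (twinOrEq-sym ρx) ρy

  twin-neighbour : ∀ {a b c} → TwinOrEq a b → TwinOrEq a c → c ≢ a → Adj G a b → Adj G a c
  twin-neighbour {a} {b} {c} ab ac c≢a a~b with c ≟ b
  ... | yes refl = a~b
  ... | no c≢b = from (proj₂ tab c c≢a c≢b) (adj-sym (to (proj₂ tac b (adj⇒≢ a~b ∘ sym) (c≢b ∘ sym)) a~b))
    where
    tab : Twins G a b
    tab = twinOrEq⇒twins ab (adj⇒≢ a~b)
    tac : Twins G a c
    tac = twinOrEq⇒twins ac (c≢a ∘ sym)

  class-uniform : ∀ {ρ a b c d} → TwinOrEq ρ a → TwinOrEq ρ b → TwinOrEq ρ c → TwinOrEq ρ d →
                  c ≢ d → Adj G a b → Adj G c d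
  class-uniform {ρ} {a} {b} {c} {d} ρa ρb ρc ρd c≢d a~b with c ≟ a
  ... | yes refl = twin-neighbour (same-class ρa ρb) (same-class ρa ρd) (c≢d ∘ sym) a~b
  ... | no c≢a = twin-neighbour (same-class ρc ρa) (same-class ρc ρd) (c≢d ∘ sym)
                   (adj-sym (twin-neighbour (same-class ρa ρb) (same-class ρa ρc) c≢a a~b))

  HasAdjacentTwin : Pred (Fin n) 0ℓ
  HasAdjacentTwin ρ = ∃[ z ] (TwinOrEq ρ z × Adj G ρ z)

  class-adj⇔ : ∀ {w x y} → TwinOrEq w x → TwinOrEq x y → x ≢ y → Adj G x y ⇔ HasAdjacentTwin w
  class-adj⇔ {w} {x} {y} wx xy x≢y = mk⇔ witness uniform
    where
    wy : TwinOrEq w y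
    wy = twinOrEq-trans wx xy
    witness : Adj G x y → HasAdjacentTwin w
    witness x~y with w ≟ x
    ... | yes refl = y , wy , x~y
    ... | no w≢x = x , wx , class-uniform wx wy twinOrEq-refl wx w≢x x~y
    uniform : HasAdjacentTwin w → Adj G x y
    uniform (z , wz , w~z) = class-uniform twinOrEq-refl wz wx wy x≢y w~z

  twins-lift⇔ : ∀ {x x′ y y′} → TwinOrEq x x′ → TwinOrEq y y′ → ¬ TwinOrEq x y →
                Adj G x y ⇔ Adj G x′ y′
  twins-lift⇔ {x} {x′} {y} {y′} xx′ yy′ x≁y =
    mk⇔ (lift xx′ yy′ x≁y) (lift (twinOrEq-sym xx′) (twinOrEq-sym yy′) x′≁y′)
    where
    x′≁y′ : ¬ TwinOrEq x′ y′
    x′≁y′ x′y′ = x≁y (twinOrEq-trans xx′ (twinOrEq-trans x′y′ (twinOrEq-sym yy′)))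
    lift-left : ∀ {a a′ b} → TwinOrEq a a′ → ¬ TwinOrEq a b → Adj G a b → Adj G a′ b
    lift-left (inj₁ refl) _ a~b = a~b
    lift-left {a} {a′} {b} (inj₂ t) a≁b = to (proj₂ t b (a≁b ∘ inj₁ ∘ sym) (a≁b ∘ λ { refl → inj₂ t }))
    lift : ∀ {a a′ b b′} → TwinOrEq a a′ → TwinOrEq b b′ → ¬ TwinOrEq a b → Adj G a b → Adj G a′ b′
    lift aa′ bb′ a≁b =
      adj-sym ∘ lift-left bb′ (a≁b ∘ twinOrEq-trans aa′ ∘ twinOrEq-sym) ∘ adj-sym ∘ lift-left aa′ a≁b

  module _ (adj? : Decidable (Adj G)) where

    twins? : Decidable (Twins G)
    twins? u v =
      ¬? (u ≟ v) ×-dec Finₚ.all? λ w → ¬? (w ≟ u) →-dec (¬? (w ≟ v) →-dec (adj? u w ⇔? adj? v w))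

    twinOrEq? : Decidable TwinOrEq
    twinOrEq? x y = (x ≟ y) ⊎-dec twins? x y

    hasAdjacentTwin? : Decidable₁ HasAdjacentTwin
    hasAdjacentTwin? ρ = Finₚ.any? λ z → twinOrEq? ρ z ×-dec adj? ρ z

module Representatives {n} {_~_ : Rel (Fin n) 0ℓ}
                       (~-isEquivalence : IsEquivalence _~_) (_~?_ : Decidable _~_) where

  open IsEquivalence ~-isEquivalence renaming (refl to ~-refl; sym to ~-sym; trans to ~-trans)

  opaque
    first-related : ∀ x → ∃[ z ] (x ~ z × ∀ {w} → x ~ w → toℕ z ≤ toℕ w)
    first-related x = least (x ~?_) ~-refl

  rep : Fin n → Fin n
  rep x = proj₁ (first-related x)

  rep-related : ∀ x → x ~ rep x
  rep-related x = proj₁ (proj₂ (first-related x))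

  rep-cong : ∀ {x y} → x ~ y → rep x ≡ rep y
  rep-cong {x} {y} x~y = Finₚ.≤-antisym
    (proj₂ (proj₂ (first-related x)) (~-trans x~y (rep-related y)))
    (proj₂ (proj₂ (first-related y)) (~-trans (~-sym x~y) (rep-related x)))

  rep-sound : ∀ {x y} → rep x ≡ rep y → x ~ y
  rep-sound {x} {y} rx≡ry = ~-trans (rep-related x) (subst (_~ y) (sym rx≡ry) (~-sym (rep-related y)))

-- A realizer whose twin classes are runs

TwinRun : ∀ {n} → Graph n → Permutation′ n → Permutation′ n → Fin n → Fin n → Set
TwinRun G σ π u v = ∃[ a ] ∃[ b ] ∃[ d ] (ConsecutiveRun π a b d ×
  InSegment a b (σ ⟨$⟩ˡ u) × InSegment a b (σ ⟨$⟩ˡ v) × (Adj G u v ⇔ (d ≡ decreasing)))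

twinRun-sym : ∀ {n} {G : Graph n} {σ π u v} → TwinRun G σ π u v → TwinRun G σ π v u
twinRun-sym {G = G} (a , b , d , run , u∈ , v∈ , adj⇔) =
  a , b , d , run , v∈ , u∈ , adj⇔ ⇔-∘ mk⇔ (Graph.sym G) (Graph.sym G)

module TwinRealizer {n} (G : Graph n) (pos val : Fin n → Fin n)
                    (pos-injective : Injective _≡_ _≡_ pos) (val-injective : Injective _≡_ _≡_ val)
                    (represents : Represents G (toℕ ∘ pos) (toℕ ∘ val)) where

  open TwinClasses G
  adj? : Decidable (Adj G)
  adj? = represents⇒adj? {G = G} {f = toℕ ∘ pos} (pos-injective ∘ Finₚ.toℕ-injective) represents
  open Representatives twinOrEq-isEquivalence (twinOrEq? adj?)

  classDirection : Fin n → Direction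
  classDirection ρ = direction (hasAdjacentTwin? adj? ρ)

  Class : Fin n → Pred (Fin n) 0ℓ
  Class u y = rep y ≡ rep u

  -- toℕ (combine i k) encodes the pair (i , k) in lexicographic order
  opaque
    key₁ : Fin n → ℕ
    key₁ x = toℕ (combine (pos (rep x)) (pos x))

    key₂ : Fin n → ℕ
    key₂ x = toℕ (combine (val (rep x)) (orient (classDirection (rep x)) (pos x)))

    key₁-injective : Injective _≡_ _≡_ key₁
    key₁-injective {x} {y} k≡ =
      pos-injective (Finₚ.combine-injectiveʳ (pos (rep x)) (pos x) (pos (rep y)) (pos y)
                                             (Finₚ.toℕ-injective k≡))

    key₂-injective : Injective _≡_ _≡_ key₂
    key₂-injective {x} {y} k≡ =
      pos-injective (orient-injective (classDirection (rep y))
        (subst (λ ρ → orient (classDirection ρ) (pos x) ≡ oy) same-rep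
               (Finₚ.combine-injectiveʳ (val (rep x)) ox (val (rep y)) oy combined)))
      where
      ox oy : Fin n
      ox = orient (classDirection (rep x)) (pos x)
      oy = orient (classDirection (rep y)) (pos y)
      combined : combine (val (rep x)) ox ≡ combine (val (rep y)) oy
      combined = Finₚ.toℕ-injective k≡
      same-rep : rep x ≡ rep y
      same-rep = val-injective (Finₚ.combine-injectiveˡ (val (rep x)) ox (val (rep y)) oy combined)

    key₁-in-class : ∀ {u y z} → Class u y → Class u z → key₁ y < key₁ z ⇔ toℕ (pos y) < toℕ (pos z)
    key₁-in-class uy uz = combine-<⇔-sameˡ (cong pos (trans uy (sym uz)))

    key₂-in-class : ∀ {u y z} → Class u y → Class u z →
                    key₂ y < key₂ z ⇔
                    toℕ (orient (classDirection (rep u)) (pos y)) < toℕ (orient (classDirection (rep u)) (pos z))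
    key₂-in-class {u} {y} {z} uy uz =
      subst₂ (λ a b → a < b ⇔ toℕ (orient d (pos y)) < toℕ (orient d (pos z)))
             (sym (key₂-at uy)) (sym (key₂-at uz)) (combine-<⇔-sameˡ {i = val (rep u)} refl)
      where
      d : Direction
      d = classDirection (rep u)
      key₂-at : ∀ {y ρ} → rep y ≡ ρ → key₂ y ≡ toℕ (combine (val ρ) (orient (classDirection ρ) (pos y)))
      key₂-at {y} = cong (λ ρ → toℕ (combine (val ρ) (orient (classDirection ρ) (pos y))))

    key₁-across : ∀ {x y} → rep x ≢ rep y → key₁ x < key₁ y ⇔ toℕ (pos (rep x)) < toℕ (pos (rep y))
    key₁-across distinct = combine-<⇔-distinctˡ (distinct ∘ pos-injective)

    key₂-across : ∀ {x y} → rep x ≢ rep y → key₂ x < key₂ y ⇔ toℕ (val (rep x)) < toℕ (val (rep y))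
    key₂-across distinct = combine-<⇔-distinctˡ (distinct ∘ val-injective)

    class-convex₁ : ∀ {u} → Convex key₁ (Class u)
    class-convex₁ ua ub a≤y y≤b =
      trans (pos-injective (combine-squeezeˡ (cong pos (trans ua (sym ub))) a≤y y≤b)) ua

    class-convex₂ : ∀ {u} → Convex key₂ (Class u)
    class-convex₂ ua ub a≤y y≤b =
      trans (val-injective (combine-squeezeˡ (cong val (trans ua (sym ub))) a≤y y≤b)) ua

  class-monotone : ∀ u → Monotone (classDirection (rep u)) key₁ key₂ (Class u)
  class-monotone u = orient-monotone (classDirection (rep u)) key₁-in-class key₂-in-class

  same-class-represents : ∀ {x y} → rep x ≡ rep y → key₁ x < key₁ y → Adj G x y ⇔ key₂ y < key₂ x
  same-class-represents {x} {y} same x<y = begin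
    Adj G x y                            ≈⟨ class-adj⇔ (twinOrEq-sym (rep-related x)) (rep-sound same) x≢y ⟩
    HasAdjacentTwin (rep x)              ≈⟨ direction⇔ (hasAdjacentTwin? adj? (rep x)) ⟩
    d ≡ decreasing                       ≈⟨ orient-reverses⇔ d px<py ⟨
    toℕ (orient d (pos y)) < toℕ (orient d (pos x)) ≈⟨ key₂-in-class (sym same) refl ⟨
    key₂ y < key₂ x                      ∎
    where
    open ⇔-Reasoning
    d : Direction
    d = classDirection (rep x)
    px<py : toℕ (pos x) < toℕ (pos y)
    px<py = to (key₁-in-class {x} refl (sym same)) x<y
    x≢y : x ≢ y
    x≢y refl = <-irrefl refl px<py

  distinct-classes-represent : ∀ {x y} → rep x ≢ rep y → key₁ x < key₁ y → Adj G x y ⇔ key₂ y < key₂ x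
  distinct-classes-represent {x} {y} distinct x<y = begin
    Adj G x y                             ≈⟨ twins-lift⇔ (rep-related x) (rep-related y) (distinct ∘ rep-cong) ⟩
    Adj G (rep x) (rep y)                 ≈⟨ represents (rep x) (rep y) rx<ry ⟩
    toℕ (val (rep y)) < toℕ (val (rep x)) ≈⟨ key₂-across (distinct ∘ sym) ⟨
    key₂ y < key₂ x                       ∎
    where
    open ⇔-Reasoning
    rx<ry : toℕ (pos (rep x)) < toℕ (pos (rep y))
    rx<ry = to (key₁-across distinct) x<y

  keys-represent : Represents G key₁ key₂
  keys-represent x y = by-class (rep x ≟ rep y)
    where
    by-class : Dec (rep x ≡ rep y) → key₁ x < key₁ y → Adj G x y ⇔ key₂ y < key₂ x
    by-class (yes same)    = same-class-represents same
    by-class (no distinct) = distinct-classes-represent distinct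

  twins-adj⇔ : ∀ {u v} → Twins G u v → Adj G u v ⇔ classDirection (rep u) ≡ decreasing
  twins-adj⇔ {u} t =
    direction⇔ (hasAdjacentTwin? adj? (rep u)) ⇔-∘ class-adj⇔ (twinOrEq-sym (rep-related u)) (inj₂ t) (proj₁ t)

  open RankRealizer key₁-injective key₂-injective public

  realizer : IsRealizer G σ′ π′
  realizer = represents⇒realizer {G} keys-represent

  twin-run : ∀ {u v} → Twins G u v → key₁ u ≤ key₁ v → TwinRun G σ′ π′ u v
  twin-run {u} {v} t u≤v =
    P.rankFin u , P.rankFin v , classDirection (rep u) ,
    consecutiveRun class-convex₁ class-convex₂ (classDirection (rep u)) (class-monotone u)
                   refl (sym (rep-cong (inj₂ t))) u≤v ,
    (≤-refl , a≤b) , (a≤b , ≤-refl) , twins-adj⇔ t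
    where
    a≤b : toℕ (P.rankFin u) ≤ toℕ (P.rankFin v)
    a≤b = rankFin-mono u≤v

  twin-runs : ∀ u v → Twins G u v → TwinRun G σ′ π′ u v
  twin-runs u v t = [ twin-run t , swapped ]′ (≤-total (key₁ u) (key₁ v))
    where
    swapped : key₁ v ≤ key₁ u → TwinRun G σ′ π′ u v
    swapped v≤u = twinRun-sym {G = G} {σ′} {π′} (twin-run (twins-sym t) v≤u)

lemma4p2 : ∀ (n : ℕ) (G : Graph n) → IsPermutationGraph G →
    ∃[ σ ] ∃[ π ] (IsRealizer G σ π ×
      (∀ u v → Twins G u v →
        ∃[ a ] ∃[ b ] ∃[ d ] (ConsecutiveRun π a b d ×
          InSegment a b (σ ⟨$⟩ˡ u) × InSegment a b (σ ⟨$⟩ˡ v) ×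
          (Adj G u v ⇔ (d ≡ decreasing)))))
lemma4p2 n G (σ , π , realizes) = σ′ , π′ , realizer , twin-runs
  where
  open TwinRealizer G (σ ⟨$⟩ˡ_) ((π ⟨$⟩ʳ_) ∘ (σ ⟨$⟩ˡ_)) (⟨$⟩ˡ-injective σ)
                      (⟨$⟩ˡ-injective σ ∘ ⟨$⟩ʳ-injective π) (realizer⇒represents {G = G} {σ} {π} realizes)
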